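{- Let $q=x+yi+zj+tk\in\mathbb H(\mathbb Z)$ and let $n_1=2(xz+yt)$, $n_2=2(zt-xy)$, $n_3=x^2-y^2-z^2+t^2$ (so that $n_1i+n_2j+n_3k=q\,k\,\overline{q}$). If $\gcd(n_1,n_2,n_3)=n>1$, then $q=q'\eta$ for some $q'\in\mathbb H(\mathbb Z)$ and some $\eta\in\{1+i,\ 1+j\}\cup\{\alpha+\beta k:\ \alpha,\beta\in\mathbb Z,\ \alpha^2+\beta^2>1\}$.
   Context: $\mathbb H(\mathbb R)$ is Hamilton's quaternion algebra: the real algebra with basis $1,i,j,k$ and $i^2=j^2=k^2=-1$, $ij=-ji=k$, $jk=-kj=i$, $ki=-ik=j$. $\mathbb H(\mathbb Z)$ is the set of quaternions with all four coordinates integers. For $q=x+yi+zj+tk$, $\overline q=x-yi-zj-tk$. -}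

module Defs where

open import Data.Integer using (ℤ; +_; _+_; _-_; _*_; -_; ∣_∣)
open import Data.Nat using (ℕ)
import Data.Nat.GCD as ℕG
open import Data.Product using (_×_; ∃-syntax; _,_)
open import Data.Sum using (_⊎_)
open import Relation.Binary.PropositionalEquality using (_≡_)

record ℍℤ : Set where
  constructor quat
  field
    re : ℤ
    ci : ℤ
    cj : ℤ
    ck : ℤ
open ℍℤ public

-- Hamilton product (i² = j² = k² = -1, ij = k, jk = i, ki = j)
infixl 7 _·_
_·_ : ℍℤ → ℍℤ → ℍℤ
quat a1 b1 c1 d1 · quat a2 b2 c2 d2 = quat
  (a1 * a2 - b1 * b2 - c1 * c2 - d1 * d2)
  (a1 * b2 + b1 * a2 + c1 * d2 - d1 * c2)
  (a1 * c2 - b1 * d2 + c1 * a2 + d1 * b2)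
  (a1 * d2 + b1 * c2 - c1 * b2 + d1 * a2)

conj : ℍℤ → ℍℤ
conj (quat x y z t) = quat x (- y) (- z) (- t)

-- the components n₁, n₂, n₃ of q k q̄ = n₁ i + n₂ j + n₃ k
n₁ n₂ n₃ : ℍℤ → ℤ
n₁ (quat x y z t) = + 2 * (x * z + y * t)
n₂ (quat x y z t) = + 2 * (z * t - x * y)
n₃ (quat x y z t) = x * x - y * y - z * z + t * t

gcd3 : ℤ → ℤ → ℤ → ℕ
gcd3 a b c = ℕG.gcd (ℕG.gcd ∣ a ∣ ∣ b ∣) ∣ c ∣

data Eta : ℍℤ → Set where
  one+i : Eta (quat (+ 1) (+ 1) (+ 0) (+ 0))
  one+j : Eta (quat (+ 1) (+ 0) (+ 1) (+ 0))
  α+βk  : (α β : ℤ) → Data.Integer._<_ (+ 1) (α * α + β * β) → Eta (quat α (+ 0) (+ 0) β)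

-- Write q = u + i w with u = x + t k and w = y − z k in the Gaussian ring ℤ[k] ⊂ ℍ(ℤ); then
-- 2 u w̄ = −n₂ + n₁ k and u ū − w w̄ = n₃. Since ℤ[k] is Euclidean, u and w have a gcd g with
-- u = u′ g, w = w′ g and g = a u + b w, and right multiplication by g respects the splitting,
-- so q = (u′ + i w′) g. If N(g) > 1, take η = g; if g = 0 then q = 0 = 0 · 2. If g is a
-- unit, u and w are coprime, which puts 2 in the ideal generated by 2 u w̄, its conjugate and
-- u ū − w w̄; hence n = 2. Then x² − y² − z² + t² is even, so x, y, z, t split into two pairs
-- of equal parity, and q is right divisible by 1 + i, 1 + j or 1 + k accordingly.
module Submission where

open import Defs
open import Data.Nat using (ℕ; _<_)
open import Data.Product using (_×_; ∃-syntax)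
open import Relation.Binary.PropositionalEquality using (_≡_)

open import Algebra.Bundles using (CommutativeRing)
open import Data.Integer using (ℤ; +_; -[1+_]; _+_; _-_; _*_; -_; ∣_∣; +<+) renaming (_<_ to _<ℤ_)
import Data.Integer.Properties as ℤ
open import Data.Integer.DivMod using (_/ℕ_; _%ℕ_; a≡a%ℕn+[a/ℕn]*n; n%ℕd<d)
open import Data.Integer.Divisibility.Signed
  using (_∣_; divides; ∣ᵤ⇒∣; ∣⇒∣ᵤ; ∣-refl; ∣m∣n⇒∣m+n; ∣m⇒∣-m; ∣m∣n⇒∣m-n; ∣n⇒∣m*n; ∣m⇒∣m*n)
open import Data.Integer.Tactic.RingSolver using (solve-∀; solve)
open import Data.List using (_∷_; [])
open import Data.Maybe using (Maybe; just; nothing)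
import Data.Nat as ℕ
open import Data.Nat using (zero; suc; NonZero; _≤_; s≤s; z≤n)
import Data.Nat.Properties as ℕ
import Data.Nat.Divisibility as ℕ
open import Data.Nat.GCD using (gcd[m,n]∣m; gcd[m,n]∣n) renaming (gcd to gcdℕ)
open import Data.Nat.Tactic.RingSolver using () renaming (solve-∀ to solve-∀ℕ)
open import Data.Product using (_,_; proj₁; proj₂)
open import Data.Sum using (_⊎_; inj₁; inj₂)
open import Relation.Nullary using (yes; no)
open import Relation.Binary.PropositionalEquality
  using (refl; sym; trans; cong; cong₂; subst; isEquivalence; module ≡-Reasoning)
import Tactic.RingSolver as Ring
import Tactic.RingSolver.Core.AlmostCommutativeRing as ACR

-- The Gaussian integers ℤ[k] = ℤ + ℤ k ⊆ ℍ(ℤ)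

infix  5 _+k_
infixl 6 _+ᵍ_
infixl 7 _*ᵍ_

record ℤ[k] : Set where
  constructor _+k_
  field
    ℜ ℑ : ℤ
open ℤ[k]

_+ᵍ_ _*ᵍ_ : ℤ[k] → ℤ[k] → ℤ[k]
(a +k b) +ᵍ (c +k d) = (a + c) +k (b + d)
(a +k b) *ᵍ (c +k d) = (a * c - b * d) +k (a * d + b * c)

-ᵍ_ conjᵍ : ℤ[k] → ℤ[k]
-ᵍ (a +k b) = - a +k - b
conjᵍ (a +k b) = a +k - b

0ᵍ 1ᵍ 2ᵍ : ℤ[k]
0ᵍ = + 0 +k + 0
1ᵍ = + 1 +k + 0
2ᵍ = + 2 +k + 0

+k-cong : ∀ {a b c d} → a ≡ c → b ≡ d → a +k b ≡ c +k d
+k-cong refl refl = refl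

ℤ[k]-commutativeRing : CommutativeRing _ _
ℤ[k]-commutativeRing = record
  { Carrier = ℤ[k] ; _≈_ = _≡_ ; _+_ = _+ᵍ_ ; _*_ = _*ᵍ_ ; -_ = -ᵍ_ ; 0# = 0ᵍ ; 1# = 1ᵍ
  ; isCommutativeRing = record
    { isRing = record
      { +-isAbelianGroup = record
        { isGroup = record
          { isMonoid = record
            { isSemigroup = record
              { isMagma = record { isEquivalence = isEquivalence ; ∙-cong = cong₂ _+ᵍ_ }
              ; assoc = λ { (a +k b) (c +k d) (e +k f) → +k-cong (ℤ.+-assoc a c e) (ℤ.+-assoc b d f) } }
            ; identity = (λ { (a +k b) → +k-cong (ℤ.+-identityˡ a) (ℤ.+-identityˡ b) })
                       , (λ { (a +k b) → +k-cong (ℤ.+-identityʳ a) (ℤ.+-identityʳ b) }) }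
          ; inverse = (λ { (a +k b) → +k-cong (ℤ.+-inverseˡ a) (ℤ.+-inverseˡ b) })
                    , (λ { (a +k b) → +k-cong (ℤ.+-inverseʳ a) (ℤ.+-inverseʳ b) })
          ; ⁻¹-cong = cong -ᵍ_ }
        ; comm = λ { (a +k b) (c +k d) → +k-cong (ℤ.+-comm a c) (ℤ.+-comm b d) } }
      ; *-cong = cong₂ _*ᵍ_
      ; *-assoc = λ { (a +k b) (c +k d) (e +k f) → +k-cong (assocℜ a b c d e f) (assocℑ a b c d e f) }
      ; *-identity = (λ { (a +k b) → +k-cong (identityˡℜ a b) (identityˡℑ a b) })
                   , (λ { (a +k b) → +k-cong (identityʳℜ a b) (identityʳℑ a b) })
      ; distrib = (λ { (a +k b) (c +k d) (e +k f) → +k-cong (distribˡℜ a b c d e f) (distribˡℑ a b c d e f) })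
                , (λ { (a +k b) (c +k d) (e +k f) → +k-cong (distribʳℜ a b c d e f) (distribʳℑ a b c d e f) }) }
    ; *-comm = λ { (a +k b) (c +k d) → +k-cong (commℜ a b c d) (commℑ a b c d) } } }
  where
  assocℜ : ∀ a b c d e f → (a * c - b * d) * e - (a * d + b * c) * f ≡ a * (c * e - d * f) - b * (c * f + d * e)
  assocℜ = solve-∀
  assocℑ : ∀ a b c d e f → (a * c - b * d) * f + (a * d + b * c) * e ≡ a * (c * f + d * e) + b * (c * e - d * f)
  assocℑ = solve-∀
  identityˡℜ : ∀ a b → + 1 * a - + 0 * b ≡ a
  identityˡℜ = solve-∀
  identityˡℑ : ∀ a b → + 1 * b + + 0 * a ≡ b
  identityˡℑ = solve-∀
  identityʳℜ : ∀ a b → a * + 1 - b * + 0 ≡ a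
  identityʳℜ = solve-∀
  identityʳℑ : ∀ a b → a * + 0 + b * + 1 ≡ b
  identityʳℑ = solve-∀
  distribˡℜ : ∀ a b c d e f → a * (c + e) - b * (d + f) ≡ (a * c - b * d) + (a * e - b * f)
  distribˡℜ = solve-∀
  distribˡℑ : ∀ a b c d e f → a * (d + f) + b * (c + e) ≡ (a * d + b * c) + (a * f + b * e)
  distribˡℑ = solve-∀
  distribʳℜ : ∀ a b c d e f → (c + e) * a - (d + f) * b ≡ (c * a - d * b) + (e * a - f * b)
  distribʳℜ = solve-∀
  distribʳℑ : ∀ a b c d e f → (c + e) * b + (d + f) * a ≡ (c * b + d * a) + (e * b + f * a)
  distribʳℑ = solve-∀
  commℜ : ∀ a b c d → a * c - b * d ≡ c * a - d * b
  commℜ = solve-∀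
  commℑ : ∀ a b c d → a * d + b * c ≡ c * b + d * a
  commℑ = solve-∀

-- Lets the ring solver discard coefficients that evaluate to zero.
0ᵍ≟_ : ∀ g → Maybe (0ᵍ ≡ g)
0ᵍ≟ (+ zero +k + zero) = just refl
0ᵍ≟ _                  = nothing

ℤ[k]-ring : ACR.AlmostCommutativeRing _ _
ℤ[k]-ring = ACR.fromCommutativeRing ℤ[k]-commutativeRing 0ᵍ≟_

conjᵍ-+ᵍ : ∀ g h → conjᵍ (g +ᵍ h) ≡ conjᵍ g +ᵍ conjᵍ h
conjᵍ-+ᵍ (a +k b) (c +k d) = +k-cong refl (ℤ.neg-distrib-+ b d)

conjᵍ-*ᵍ : ∀ g h → conjᵍ (g *ᵍ h) ≡ conjᵍ g *ᵍ conjᵍ h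
conjᵍ-*ᵍ (a +k b) (c +k d) = +k-cong (conjℜ a b c d) (conjℑ a b c d)
  where
  conjℜ : ∀ a b c d → a * c - b * d ≡ a * c - (- b) * (- d)
  conjℜ = solve-∀
  conjℑ : ∀ a b c d → - (a * d + b * c) ≡ a * (- d) + (- b) * c
  conjℑ = solve-∀

conjᵍ-involutive : ∀ g → conjᵍ (conjᵍ g) ≡ g
conjᵍ-involutive (a +k b) = +k-cong refl (ℤ.neg-involutive b)

norm : ℤ[k] → ℕ
norm (a +k b) = ∣ a ∣ ℕ.* ∣ a ∣ ℕ.+ ∣ b ∣ ℕ.* ∣ b ∣

+∣i∣*∣i∣≡i*i : ∀ i → + (∣ i ∣ ℕ.* ∣ i ∣) ≡ i * i
+∣i∣*∣i∣≡i*i (+ n)    = ℤ.pos-* n n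
+∣i∣*∣i∣≡i*i -[1+ n ] = refl

+norm≡ℜ²+ℑ² : ∀ g → + norm g ≡ ℜ g * ℜ g + ℑ g * ℑ g
+norm≡ℜ²+ℑ² (a +k b) = trans (ℤ.pos-+ (∣ a ∣ ℕ.* ∣ a ∣) _) (cong₂ _+_ (+∣i∣*∣i∣≡i*i a) (+∣i∣*∣i∣≡i*i b))

*ᵍ-conjᵍ≡norm : ∀ g → g *ᵍ conjᵍ g ≡ + norm g +k + 0
*ᵍ-conjᵍ≡norm (a +k b) = +k-cong (trans (normℜ a b) (sym (+norm≡ℜ²+ℑ² (a +k b)))) (normℑ a b)
  where
  normℜ : ∀ a b → a * a - b * - b ≡ a * a + b * b
  normℜ = solve-∀
  normℑ : ∀ a b → a * - b + b * a ≡ + 0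
  normℑ = solve-∀

norm-*ᵍ : ∀ g h → norm (g *ᵍ h) ≡ norm g ℕ.* norm h
norm-*ᵍ g@(a +k b) h@(c +k d) = ℤ.+-injective (begin
  + norm (g *ᵍ h)                       ≡⟨ +norm≡ℜ²+ℑ² (g *ᵍ h) ⟩
  ℜ (g *ᵍ h) * ℜ (g *ᵍ h) + ℑ (g *ᵍ h) * ℑ (g *ᵍ h) ≡⟨ brahmagupta a b c d ⟩
  (a * a + b * b) * (c * c + d * d)     ≡⟨ cong₂ _*_ (+norm≡ℜ²+ℑ² g) (+norm≡ℜ²+ℑ² h) ⟨
  + norm g * + norm h                   ≡⟨ ℤ.pos-* (norm g) (norm h) ⟨
  + (norm g ℕ.* norm h)                 ∎)
  where
  open ≡-Reasoning
  brahmagupta : ∀ a b c d → (a * c - b * d) * (a * c - b * d) + (a * d + b * c) * (a * d + b * c)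
                          ≡ (a * a + b * b) * (c * c + d * d)
  brahmagupta = solve-∀

norm-conjᵍ : ∀ g → norm (conjᵍ g) ≡ norm g
norm-conjᵍ (a +k b) = cong (λ n → ∣ a ∣ ℕ.* ∣ a ∣ ℕ.+ n ℕ.* n) (ℤ.∣-i∣≡∣i∣ b)

norm≡0⇒≡0ᵍ : ∀ g → norm g ≡ 0 → g ≡ 0ᵍ
norm≡0⇒≡0ᵍ (a +k b) norm≡0 =
  +k-cong (square≡0 a (ℕ.m+n≡0⇒m≡0 _ norm≡0)) (square≡0 b (ℕ.m+n≡0⇒n≡0 (∣ a ∣ ℕ.* ∣ a ∣) norm≡0))
  where
  square≡0 : ∀ i → ∣ i ∣ ℕ.* ∣ i ∣ ≡ 0 → i ≡ + 0
  square≡0 (+ zero)  _  = refl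
  square≡0 (+ suc n) ()
  square≡0 -[1+ n ]  ()

-- Euclidean division in ℤ[k]

2*[n∸r]≤n : ∀ {n r} → r ≤ n → n < 2 ℕ.* r → 2 ℕ.* (n ℕ.∸ r) ≤ n
2*[n∸r]≤n {n} {r} r≤n n<2r = subst (2 ℕ.* k ≤_) r+k≡n
  (ℕ.+-mono-≤ k≤r (ℕ.≤-reflexive (ℕ.+-identityʳ k)))
  where
  k = n ℕ.∸ r
  r+k≡n : r ℕ.+ k ≡ n
  r+k≡n = ℕ.m+[n∸m]≡n r≤n
  k≤r : k ≤ r
  k≤r = ℕ.<⇒≤ (subst (k <_) (ℕ.+-identityʳ r)
          (ℕ.+-cancelˡ-< r k (r ℕ.+ 0) (subst (_< 2 ℕ.* r) (sym r+k≡n) n<2r)))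

nearestDivMod : (A : ℤ) (n : ℕ) .{{_ : NonZero n}} →
                ∃[ s ] ∃[ e ] (A ≡ s * + n + e × 2 ℕ.* ∣ e ∣ ≤ n)
nearestDivMod A n with 2 ℕ.* (A %ℕ n) ℕ.≤? n
... | yes 2r≤n =
  A /ℕ n , + (A %ℕ n) , trans (a≡a%ℕn+[a/ℕn]*n A n) (ℤ.+-comm (+ (A %ℕ n)) (A /ℕ n * + n)) , 2r≤n
... | no  2r≰n = s + + 1 , - + k , A≡ ,
                 subst (λ m → 2 ℕ.* m ≤ n) (sym (ℤ.∣-i∣≡∣i∣ (+ k))) (2*[n∸r]≤n r≤n (ℕ.≰⇒> 2r≰n))
  where
  open ≡-Reasoning
  r = A %ℕ n
  s = A /ℕ n
  k = n ℕ.∸ r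
  r≤n : r ≤ n
  r≤n = ℕ.<⇒≤ (n%ℕd<d A n)
  +r+k≡+n : + r + + k ≡ + n
  +r+k≡+n = trans (sym (ℤ.pos-+ r k)) (cong +_ (ℕ.m+[n∸m]≡n r≤n))
  carry : ∀ r k s → r + s * (r + k) ≡ (s + + 1) * (r + k) + - k
  carry = solve-∀
  A≡ : A ≡ (s + + 1) * + n + - + k
  A≡ = begin
    A                           ≡⟨ a≡a%ℕn+[a/ℕn]*n A n ⟩
    + r + s * + n               ≡⟨ cong (λ m → + r + s * m) +r+k≡+n ⟨
    + r + s * (+ r + + k)       ≡⟨ carry (+ r) (+ k) s ⟩
    (s + + 1) * (+ r + + k) + - + k ≡⟨ cong (λ m → (s + + 1) * m + - + k) +r+k≡+n ⟩
    (s + + 1) * + n + - + k     ∎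

sumOfHalfSquares< : ∀ {R n a b} .{{_ : NonZero n}} →
                    R ℕ.* n ≡ a ℕ.* a ℕ.+ b ℕ.* b → 2 ℕ.* a ≤ n → 2 ℕ.* b ≤ n → R < n
sumOfHalfSquares< {R} {n} {a} {b} Rn≡ 2a≤n 2b≤n = half<n R 2R≤n
  where
  open ℕ.≤-Reasoning
  2R≤n : 2 ℕ.* R ≤ n
  2R≤n = ℕ.*-cancelʳ-≤ (2 ℕ.* R) n n (ℕ.*-cancelʳ-≤ (2 ℕ.* R ℕ.* n) (n ℕ.* n) 2 (begin
    2 ℕ.* R ℕ.* n ℕ.* 2                               ≡⟨ ×4 R n ⟩
    2 ℕ.* 2 ℕ.* (R ℕ.* n)                             ≡⟨ cong (2 ℕ.* 2 ℕ.*_) Rn≡ ⟩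
    2 ℕ.* 2 ℕ.* (a ℕ.* a ℕ.+ b ℕ.* b)                 ≡⟨ ×4-distrib a b ⟩
    2 ℕ.* a ℕ.* (2 ℕ.* a) ℕ.+ 2 ℕ.* b ℕ.* (2 ℕ.* b)   ≤⟨ ℕ.+-mono-≤ (ℕ.*-mono-≤ 2a≤n 2a≤n) (ℕ.*-mono-≤ 2b≤n 2b≤n) ⟩
    n ℕ.* n ℕ.+ n ℕ.* n                               ≡⟨ n²+n² n ⟩
    n ℕ.* n ℕ.* 2                                     ∎))
    where
    ×4 : ∀ R n → 2 ℕ.* R ℕ.* n ℕ.* 2 ≡ 2 ℕ.* 2 ℕ.* (R ℕ.* n)
    ×4 = solve-∀ℕ
    ×4-distrib : ∀ a b → 2 ℕ.* 2 ℕ.* (a ℕ.* a ℕ.+ b ℕ.* b) ≡ 2 ℕ.* a ℕ.* (2 ℕ.* a) ℕ.+ 2 ℕ.* b ℕ.* (2 ℕ.* b)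
    ×4-distrib = solve-∀ℕ
    n²+n² : ∀ n → n ℕ.* n ℕ.+ n ℕ.* n ≡ n ℕ.* n ℕ.* 2
    n²+n² = solve-∀ℕ
  half<n : ∀ R → 2 ℕ.* R ≤ n → R < n
  half<n zero    _    = ℕ.>-nonZero⁻¹ n
  half<n (suc R) 2R≤n = ℕ.<-≤-trans (ℕ.m<m+n (suc R) ℕ.z<s) 2R≤n

-- The quotient s rounds both coordinates of u w̄ / N(w) to the nearest integer.
divModᵍ : ∀ u w .{{_ : NonZero (norm w)}} → ∃[ s ] ∃[ r ] (u ≡ s *ᵍ w +ᵍ r × norm r < norm w)
divModᵍ u w with nearestDivMod (ℜ (u *ᵍ conjᵍ w)) (norm w) | nearestDivMod (ℑ (u *ᵍ conjᵍ w)) (norm w)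
... | s₁ , e₁ , ℜ≡ , 2e₁≤n | s₂ , e₂ , ℑ≡ , 2e₂≤n =
  s , r , split u s w , sumOfHalfSquares< {a = ∣ e₁ ∣} {b = ∣ e₂ ∣} rn≡e₁²+e₂² 2e₁≤n 2e₂≤n
  where
  open ≡-Reasoning
  n = norm w
  N = + n +k + 0
  s = s₁ +k s₂
  e = e₁ +k e₂
  r = u +ᵍ -ᵍ (s *ᵍ w)
  split : ∀ u s w → u ≡ s *ᵍ w +ᵍ (u +ᵍ -ᵍ (s *ᵍ w))
  split = Ring.solve-∀ ℤ[k]-ring
  expand : ∀ u s w w̄ → (u +ᵍ -ᵍ (s *ᵍ w)) *ᵍ w̄ ≡ u *ᵍ w̄ +ᵍ -ᵍ (s *ᵍ (w *ᵍ w̄))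
  expand = Ring.solve-∀ ℤ[k]-ring
  cancel : ∀ a b → a +ᵍ b +ᵍ -ᵍ a ≡ b
  cancel = Ring.solve-∀ ℤ[k]-ring
  ℜ-shape : ∀ s₁ s₂ n e₁ → s₁ * n + e₁ ≡ (s₁ * n - s₂ * + 0) + e₁
  ℜ-shape = solve-∀
  ℑ-shape : ∀ s₁ s₂ n e₂ → s₂ * n + e₂ ≡ (s₁ * + 0 + s₂ * n) + e₂
  ℑ-shape = solve-∀
  uw̄≡sN+e : u *ᵍ conjᵍ w ≡ s *ᵍ N +ᵍ e
  uw̄≡sN+e = +k-cong (trans ℜ≡ (ℜ-shape s₁ s₂ (+ n) e₁)) (trans ℑ≡ (ℑ-shape s₁ s₂ (+ n) e₂))
  rw̄≡e : r *ᵍ conjᵍ w ≡ e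
  rw̄≡e = begin
    r *ᵍ conjᵍ w                                 ≡⟨ expand u s w (conjᵍ w) ⟩
    u *ᵍ conjᵍ w +ᵍ -ᵍ (s *ᵍ (w *ᵍ conjᵍ w))     ≡⟨ cong₂ (λ p m → p +ᵍ -ᵍ (s *ᵍ m)) uw̄≡sN+e (*ᵍ-conjᵍ≡norm w) ⟩
    s *ᵍ N +ᵍ e +ᵍ -ᵍ (s *ᵍ N)                   ≡⟨ cancel (s *ᵍ N) e ⟩
    e                                            ∎
  rn≡e₁²+e₂² : norm r ℕ.* n ≡ norm e
  rn≡e₁²+e₂² = begin
    norm r ℕ.* n                 ≡⟨ cong (norm r ℕ.*_) (norm-conjᵍ w) ⟨
    norm r ℕ.* norm (conjᵍ w)    ≡⟨ norm-*ᵍ r (conjᵍ w) ⟨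
    norm (r *ᵍ conjᵍ w)          ≡⟨ cong norm rw̄≡e ⟩
    norm e                       ∎

record Bézout (u w : ℤ[k]) : Set where
  field
    gcd u′ w′ a b : ℤ[k]
    u≡u′*gcd : u ≡ u′ *ᵍ gcd
    w≡w′*gcd : w ≡ w′ *ᵍ gcd
    gcd≡au+bw : gcd ≡ a *ᵍ u +ᵍ b *ᵍ w

bézout-zero : ∀ u w → w ≡ 0ᵍ → Bézout u w
bézout-zero u w w≡0 = record
  { gcd = u ; u′ = 1ᵍ ; w′ = 0ᵍ ; a = 1ᵍ ; b = 0ᵍ
  ; u≡u′*gcd = u≡1u u
  ; w≡w′*gcd = trans w≡0 (0≡0u u)
  ; gcd≡au+bw = u≡1u+0w u w }
  where
  u≡1u : ∀ u → u ≡ 1ᵍ *ᵍ u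
  u≡1u = Ring.solve-∀ ℤ[k]-ring
  0≡0u : ∀ u → 0ᵍ ≡ 0ᵍ *ᵍ u
  0≡0u = Ring.solve-∀ ℤ[k]-ring
  u≡1u+0w : ∀ u w → u ≡ 1ᵍ *ᵍ u +ᵍ 0ᵍ *ᵍ w
  u≡1u+0w = Ring.solve-∀ ℤ[k]-ring

bézout-step : ∀ {u w} s r → u ≡ s *ᵍ w +ᵍ r → Bézout w r → Bézout u w
bézout-step {u} {w} s r u≡sw+r B = record
  { gcd = gcd ; u′ = s *ᵍ u′ +ᵍ w′ ; w′ = u′ ; a = b ; b = a +ᵍ -ᵍ (b *ᵍ s)
  ; u≡u′*gcd = begin
      u                          ≡⟨ u≡sw+r ⟩
      s *ᵍ w +ᵍ r                ≡⟨ cong₂ (λ w r → s *ᵍ w +ᵍ r) u≡u′*gcd w≡w′*gcd ⟩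
      s *ᵍ (u′ *ᵍ gcd) +ᵍ w′ *ᵍ gcd ≡⟨ factor s u′ w′ gcd ⟩
      (s *ᵍ u′ +ᵍ w′) *ᵍ gcd     ∎
  ; w≡w′*gcd = u≡u′*gcd
  ; gcd≡au+bw = begin
      gcd                                  ≡⟨ gcd≡au+bw ⟩
      a *ᵍ w +ᵍ b *ᵍ r                     ≡⟨ regroup a b s w r ⟩
      b *ᵍ (s *ᵍ w +ᵍ r) +ᵍ (a +ᵍ -ᵍ (b *ᵍ s)) *ᵍ w ≡⟨ cong (λ u → b *ᵍ u +ᵍ (a +ᵍ -ᵍ (b *ᵍ s)) *ᵍ w) u≡sw+r ⟨
      b *ᵍ u +ᵍ (a +ᵍ -ᵍ (b *ᵍ s)) *ᵍ w     ∎ }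
  where
  open ≡-Reasoning
  open Bézout B
  factor : ∀ s u′ w′ g → s *ᵍ (u′ *ᵍ g) +ᵍ w′ *ᵍ g ≡ (s *ᵍ u′ +ᵍ w′) *ᵍ g
  factor = Ring.solve-∀ ℤ[k]-ring
  regroup : ∀ a b s w r → a *ᵍ w +ᵍ b *ᵍ r ≡ b *ᵍ (s *ᵍ w +ᵍ r) +ᵍ (a +ᵍ -ᵍ (b *ᵍ s)) *ᵍ w
  regroup = Ring.solve-∀ ℤ[k]-ring

bézout-< : ∀ n u w → norm w < n → Bézout u w
bézout-< (suc n) u w N[w]<1+n with norm w ℕ.≟ 0
... | yes N[w]≡0 = bézout-zero u w (norm≡0⇒≡0ᵍ w N[w]≡0)
... | no  N[w]≢0 = fromDivision (divModᵍ u w {{ℕ.≢-nonZero N[w]≢0}})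
  where
  fromDivision : ∃[ s ] ∃[ r ] (u ≡ s *ᵍ w +ᵍ r × norm r < norm w) → Bézout u w
  fromDivision (s , r , u≡sw+r , N[r]<N[w]) =
    bézout-step s r u≡sw+r (bézout-< n w r (ℕ.<-≤-trans N[r]<N[w] (ℕ.≤-pred N[w]<1+n)))

bézout : ∀ u w → Bézout u w
bézout u w = bézout-< (suc (norm w)) u w (ℕ.n<1+n (norm w))

infix 4 _∣ᵍ_
_∣ᵍ_ : ℤ → ℤ[k] → Set
m ∣ᵍ g = (m ∣ ℜ g) × (m ∣ ℑ g)

∣ᵍ-+ᵍ : ∀ {m g h} → m ∣ᵍ g → m ∣ᵍ h → m ∣ᵍ g +ᵍ h
∣ᵍ-+ᵍ (m∣a , m∣b) (m∣c , m∣d) = ∣m∣n⇒∣m+n m∣a m∣c , ∣m∣n⇒∣m+n m∣b m∣d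

∣ᵍ-*ᵍ : ∀ {m} h {g} → m ∣ᵍ g → m ∣ᵍ h *ᵍ g
∣ᵍ-*ᵍ (a +k b) (m∣c , m∣d) = ∣m∣n⇒∣m-n (∣n⇒∣m*n a m∣c) (∣n⇒∣m*n b m∣d)
                           , ∣m∣n⇒∣m+n (∣n⇒∣m*n a m∣d) (∣n⇒∣m*n b m∣c)

∣ᵍ-conjᵍ : ∀ {m g} → m ∣ᵍ g → m ∣ᵍ conjᵍ g
∣ᵍ-conjᵍ (m∣a , m∣b) = m∣a , ∣m⇒∣-m m∣b

Coprimeᵍ : ℤ[k] → ℤ[k] → Set
Coprimeᵍ u w = ∃[ a ] ∃[ b ] (a *ᵍ u +ᵍ b *ᵍ w ≡ 1ᵍ)

norm[gcd]≡1⇒coprime : ∀ {u w} (B : Bézout u w) → norm (Bézout.gcd B) ≡ 1 → Coprimeᵍ u w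
norm[gcd]≡1⇒coprime {u} {w} B N[g]≡1 = conjᵍ gcd *ᵍ a , conjᵍ gcd *ᵍ b , (begin
  conjᵍ gcd *ᵍ a *ᵍ u +ᵍ conjᵍ gcd *ᵍ b *ᵍ w ≡⟨ factor (conjᵍ gcd) a b u w ⟩
  (a *ᵍ u +ᵍ b *ᵍ w) *ᵍ conjᵍ gcd           ≡⟨ cong (_*ᵍ conjᵍ gcd) gcd≡au+bw ⟨
  gcd *ᵍ conjᵍ gcd                          ≡⟨ *ᵍ-conjᵍ≡norm gcd ⟩
  + norm gcd +k + 0                         ≡⟨ cong (λ n → + n +k + 0) N[g]≡1 ⟩
  1ᵍ                                        ∎)
  where
  open ≡-Reasoning
  open Bézout B
  factor : ∀ c a b u w → c *ᵍ a *ᵍ u +ᵍ c *ᵍ b *ᵍ w ≡ (a *ᵍ u +ᵍ b *ᵍ w) *ᵍ c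
  factor = Ring.solve-∀ ℤ[k]-ring

conjᵍ-2*g*conjᵍ-h : ∀ g h → conjᵍ (2ᵍ *ᵍ g *ᵍ conjᵍ h) ≡ 2ᵍ *ᵍ conjᵍ g *ᵍ h
conjᵍ-2*g*conjᵍ-h g h = begin
  conjᵍ (2ᵍ *ᵍ g *ᵍ conjᵍ h)          ≡⟨ conjᵍ-*ᵍ (2ᵍ *ᵍ g) (conjᵍ h) ⟩
  conjᵍ (2ᵍ *ᵍ g) *ᵍ conjᵍ (conjᵍ h)  ≡⟨ cong₂ _*ᵍ_ (conjᵍ-*ᵍ 2ᵍ g) (conjᵍ-involutive h) ⟩
  2ᵍ *ᵍ conjᵍ g *ᵍ h                  ∎
  where open ≡-Reasoning

conjᵍ-coprime : ∀ {u w} → Coprimeᵍ u w → Coprimeᵍ (conjᵍ u) (conjᵍ w)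
conjᵍ-coprime {u} {w} (a , b , au+bw≡1) = conjᵍ a , conjᵍ b , (begin
  conjᵍ a *ᵍ conjᵍ u +ᵍ conjᵍ b *ᵍ conjᵍ w  ≡⟨ cong₂ _+ᵍ_ (conjᵍ-*ᵍ a u) (conjᵍ-*ᵍ b w) ⟨
  conjᵍ (a *ᵍ u) +ᵍ conjᵍ (b *ᵍ w)          ≡⟨ conjᵍ-+ᵍ (a *ᵍ u) (b *ᵍ w) ⟨
  conjᵍ (a *ᵍ u +ᵍ b *ᵍ w)                  ≡⟨ cong conjᵍ au+bw≡1 ⟩
  1ᵍ                                        ∎)
  where open ≡-Reasoning

-- Multiply 2 w w̄ by a u + b w = 1.
coprime⇒∣2ww̄ : ∀ {m u w} → Coprimeᵍ u w →
               m ∣ᵍ 2ᵍ *ᵍ u *ᵍ conjᵍ w → m ∣ᵍ 2ᵍ *ᵍ conjᵍ u *ᵍ w → m ∣ᵍ u *ᵍ conjᵍ u +ᵍ -ᵍ (w *ᵍ conjᵍ w) →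
               m ∣ᵍ 2ᵍ *ᵍ w *ᵍ conjᵍ w
coprime⇒∣2ww̄ {m} {u} {w} (a , b , au+bw≡1) m∣X m∣X̄ m∣D = subst (m ∣ᵍ_)
  (trans (sym (combination a b u w (conjᵍ u) (conjᵍ w)))
         (trans (cong (2ᵍ *ᵍ w *ᵍ conjᵍ w *ᵍ_) au+bw≡1) (*1ᵍ (2ᵍ *ᵍ w *ᵍ conjᵍ w))))
  (∣ᵍ-+ᵍ (∣ᵍ-+ᵍ (∣ᵍ-*ᵍ (a *ᵍ w) m∣X) (∣ᵍ-*ᵍ (b *ᵍ u) m∣X̄)) (∣ᵍ-*ᵍ (-ᵍ (2ᵍ *ᵍ b *ᵍ w)) m∣D))
  where
  combination : ∀ a b u w ū w̄ →
    2ᵍ *ᵍ w *ᵍ w̄ *ᵍ (a *ᵍ u +ᵍ b *ᵍ w)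
      ≡ (a *ᵍ w) *ᵍ (2ᵍ *ᵍ u *ᵍ w̄) +ᵍ (b *ᵍ u) *ᵍ (2ᵍ *ᵍ ū *ᵍ w)
        +ᵍ (-ᵍ (2ᵍ *ᵍ b *ᵍ w)) *ᵍ (u *ᵍ ū +ᵍ -ᵍ (w *ᵍ w̄))
  combination = Ring.solve-∀ ℤ[k]-ring
  *1ᵍ : ∀ g → g *ᵍ 1ᵍ ≡ g
  *1ᵍ = Ring.solve-∀ ℤ[k]-ring

-- Expand 2 = 2 (a u + b w) (ā ū + b̄ w̄), using u ū = (u ū − w w̄) + w w̄.
coprime⇒∣2 : ∀ {m u w} → Coprimeᵍ u w →
             m ∣ᵍ 2ᵍ *ᵍ u *ᵍ conjᵍ w → m ∣ᵍ u *ᵍ conjᵍ u +ᵍ -ᵍ (w *ᵍ conjᵍ w) → m ∣ᵍ 2ᵍ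
coprime⇒∣2 {m} {u} {w} coprime@(a , b , au+bw≡1) m∣X m∣D = subst (m ∣ᵍ_)
  (trans (sym (combination a b u w (conjᵍ a) (conjᵍ b) (conjᵍ u) (conjᵍ w)))
         (cong₂ (λ B B̄ → 2ᵍ *ᵍ B *ᵍ B̄) au+bw≡1 (proj₂ (proj₂ (conjᵍ-coprime coprime)))))
  (∣ᵍ-+ᵍ (∣ᵍ-+ᵍ (∣ᵍ-+ᵍ (∣ᵍ-*ᵍ (2ᵍ *ᵍ a *ᵍ conjᵍ a) m∣D)
                      (∣ᵍ-*ᵍ (a *ᵍ conjᵍ a +ᵍ b *ᵍ conjᵍ b) (coprime⇒∣2ww̄ coprime m∣X m∣X̄ m∣D)))
                (∣ᵍ-*ᵍ (a *ᵍ conjᵍ b) m∣X))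
         (∣ᵍ-*ᵍ (conjᵍ a *ᵍ b) m∣X̄))
  where
  m∣X̄ : m ∣ᵍ 2ᵍ *ᵍ conjᵍ u *ᵍ w
  m∣X̄ = subst (m ∣ᵍ_) (conjᵍ-2*g*conjᵍ-h u w) (∣ᵍ-conjᵍ m∣X)
  combination : ∀ a b u w ā b̄ ū w̄ →
    2ᵍ *ᵍ (a *ᵍ u +ᵍ b *ᵍ w) *ᵍ (ā *ᵍ ū +ᵍ b̄ *ᵍ w̄)
      ≡ (2ᵍ *ᵍ a *ᵍ ā) *ᵍ (u *ᵍ ū +ᵍ -ᵍ (w *ᵍ w̄)) +ᵍ (a *ᵍ ā +ᵍ b *ᵍ b̄) *ᵍ (2ᵍ *ᵍ w *ᵍ w̄)
        +ᵍ (a *ᵍ b̄) *ᵍ (2ᵍ *ᵍ u *ᵍ w̄) +ᵍ (ā *ᵍ b) *ᵍ (2ᵍ *ᵍ ū *ᵍ w)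
  combination = Ring.solve-∀ ℤ[k]-ring

-- Quaternions over ℤ[k]

-- u +i· w stands for u + i w:  (a + b k) + i (c + d k) = a + c i − d j + b k.
infix 5 _+i·_
_+i·_ : ℤ[k] → ℤ[k] → ℍℤ
(a +k b) +i· (c +k d) = quat a c (- d) b

⟦_⟧ : ℤ[k] → ℍℤ
⟦ a +k b ⟧ = quat a (+ 0) (+ 0) b

quat-cong : ∀ {a b c d a′ b′ c′ d′} → a ≡ a′ → b ≡ b′ → c ≡ c′ → d ≡ d′ → quat a b c d ≡ quat a′ b′ c′ d′
quat-cong refl refl refl refl = refl

+i·-·⟦⟧ : ∀ u w g → (u +i· w) · ⟦ g ⟧ ≡ u *ᵍ g +i· w *ᵍ g
+i·-·⟦⟧ (a +k b) (c +k d) (e +k f) =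
  quat-cong (re-eq a b c d e f) (ci-eq a b c d e f) (cj-eq a b c d e f) (ck-eq a b c d e f)
  where
  re-eq : ∀ a b c d e f → a * e - c * + 0 - - d * + 0 - b * f ≡ a * e - b * f
  re-eq = solve-∀
  ci-eq : ∀ a b c d e f → a * + 0 + c * e + - d * f - b * + 0 ≡ c * e - d * f
  ci-eq = solve-∀
  cj-eq : ∀ a b c d e f → a * + 0 - c * f + - d * e + b * + 0 ≡ - (c * f + d * e)
  cj-eq = solve-∀
  ck-eq : ∀ a b c d e f → a * f + c * + 0 - - d * + 0 + b * e ≡ a * f + b * e
  ck-eq = solve-∀

EtaDivisible : ℍℤ → Set
EtaDivisible q = ∃[ q' ] ∃[ η ] (Eta η × q ≡ q' · η)

1<norm⇒Eta⟦⟧ : ∀ g → 1 < norm g → Eta ⟦ g ⟧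
1<norm⇒Eta⟦⟧ g@(a +k b) 1<N = α+βk a b (subst (_<ℤ_ (+ 1)) (+norm≡ℜ²+ℑ² g) (+<+ 1<N))

norm[gcd]≡0⇒EtaDivisible : ∀ {u w} (B : Bézout u w) → norm (Bézout.gcd B) ≡ 0 → EtaDivisible (u +i· w)
norm[gcd]≡0⇒EtaDivisible {u} {w} B N[gcd]≡0 = 0ᵍ +i· 0ᵍ , ⟦ 2ᵍ ⟧ , 1<norm⇒Eta⟦⟧ 2ᵍ (s≤s (s≤s z≤n)) , (begin
  u +i· w                    ≡⟨ cong₂ _+i·_ u≡u′*gcd w≡w′*gcd ⟩
  u′ *ᵍ gcd +i· w′ *ᵍ gcd    ≡⟨ cong (λ g → u′ *ᵍ g +i· w′ *ᵍ g) (norm≡0⇒≡0ᵍ gcd N[gcd]≡0) ⟩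
  u′ *ᵍ 0ᵍ +i· w′ *ᵍ 0ᵍ      ≡⟨ cong₂ _+i·_ (annihilate u′) (annihilate w′) ⟩
  0ᵍ *ᵍ 2ᵍ +i· 0ᵍ *ᵍ 2ᵍ      ≡⟨ +i·-·⟦⟧ 0ᵍ 0ᵍ 2ᵍ ⟨
  (0ᵍ +i· 0ᵍ) · ⟦ 2ᵍ ⟧       ∎)
  where
  open ≡-Reasoning
  open Bézout B
  annihilate : ∀ g → g *ᵍ 0ᵍ ≡ 0ᵍ *ᵍ 2ᵍ
  annihilate = Ring.solve-∀ ℤ[k]-ring

1<norm[gcd]⇒EtaDivisible : ∀ {u w} (B : Bézout u w) → 1 < norm (Bézout.gcd B) → EtaDivisible (u +i· w)
1<norm[gcd]⇒EtaDivisible B 1<N = u′ +i· w′ , ⟦ gcd ⟧ , 1<norm⇒Eta⟦⟧ gcd 1<N ,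
  trans (cong₂ _+i·_ u≡u′*gcd w≡w′*gcd) (sym (+i·-·⟦⟧ u′ w′ gcd))
  where open Bézout B

k-part i-part : ℍℤ → ℤ[k]
k-part (quat x y z t) = x +k t
i-part (quat x y z t) = y +k - z

k-part+i·i-part : ∀ q → q ≡ k-part q +i· i-part q
k-part+i·i-part (quat x y z t) = cong (λ c → quat x y c t) (sym (ℤ.neg-involutive z))

2*k-part*conj[i-part]≡-n₂+n₁k : ∀ q → 2ᵍ *ᵍ k-part q *ᵍ conjᵍ (i-part q) ≡ - n₂ q +k n₁ q
2*k-part*conj[i-part]≡-n₂+n₁k (quat x y z t) = +k-cong (n₂-shape x y z t) (n₁-shape x y z t)
  where
  n₂-shape : ∀ x y z t → (+ 2 * x - + 0 * t) * y - (+ 2 * t + + 0 * x) * - - z ≡ - (+ 2 * (z * t - x * y))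
  n₂-shape = solve-∀
  n₁-shape : ∀ x y z t → (+ 2 * x - + 0 * t) * - - z + (+ 2 * t + + 0 * x) * y ≡ + 2 * (x * z + y * t)
  n₁-shape = solve-∀

norm[k-part]-norm[i-part]≡n₃ : ∀ q →
  k-part q *ᵍ conjᵍ (k-part q) +ᵍ -ᵍ (i-part q *ᵍ conjᵍ (i-part q)) ≡ n₃ q +k + 0
norm[k-part]-norm[i-part]≡n₃ (quat x y z t) = +k-cong (n₃-shape x y z t) (zero-shape x y z t)
  where
  n₃-shape : ∀ x y z t → (x * x - t * - t) + - (y * y - - z * - - z) ≡ x * x - y * y - z * z + t * t
  n₃-shape = solve-∀
  zero-shape : ∀ x y z t → (x * - t + t * x) + - (y * - - z + - z * y) ≡ + 0
  zero-shape = solve-∀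

gcd3∣₁ : ∀ a b c → + gcd3 a b c ∣ a
gcd3∣₁ a b c = ∣ᵤ⇒∣ (ℕ.∣-trans (gcd[m,n]∣m (gcdℕ ∣ a ∣ ∣ b ∣) ∣ c ∣) (gcd[m,n]∣m ∣ a ∣ ∣ b ∣))

gcd3∣₂ : ∀ a b c → + gcd3 a b c ∣ b
gcd3∣₂ a b c = ∣ᵤ⇒∣ (ℕ.∣-trans (gcd[m,n]∣m (gcdℕ ∣ a ∣ ∣ b ∣) ∣ c ∣) (gcd[m,n]∣n ∣ a ∣ ∣ b ∣))

gcd3∣₃ : ∀ a b c → + gcd3 a b c ∣ c
gcd3∣₃ a b c = ∣ᵤ⇒∣ (gcd[m,n]∣n (gcdℕ ∣ a ∣ ∣ b ∣) ∣ c ∣)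

coprime-parts⇒gcd3∣2 : ∀ q → Coprimeᵍ (k-part q) (i-part q) → gcd3 (n₁ q) (n₂ q) (n₃ q) ℕ.∣ 2
coprime-parts⇒gcd3∣2 q coprime = ∣⇒∣ᵤ (proj₁ (coprime⇒∣2 coprime m∣X m∣D))
  where
  m = + gcd3 (n₁ q) (n₂ q) (n₃ q)
  m∣X : m ∣ᵍ 2ᵍ *ᵍ k-part q *ᵍ conjᵍ (i-part q)
  m∣X = subst (m ∣ᵍ_) (sym (2*k-part*conj[i-part]≡-n₂+n₁k q))
          (∣m⇒∣-m (gcd3∣₂ (n₁ q) (n₂ q) (n₃ q)) , gcd3∣₁ (n₁ q) (n₂ q) (n₃ q))
  m∣D : m ∣ᵍ k-part q *ᵍ conjᵍ (k-part q) +ᵍ -ᵍ (i-part q *ᵍ conjᵍ (i-part q))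
  m∣D = subst (m ∣ᵍ_) (sym (norm[k-part]-norm[i-part]≡n₃ q))
          (gcd3∣₃ (n₁ q) (n₂ q) (n₃ q) , divides (+ 0) refl)

-- Parity

Even : ℤ → Set
Even a = + 2 ∣ a

parity : ∀ a → Even a ⊎ Even (a + + 1)
parity a with a %ℕ 2 | n%ℕd<d a 2 | a≡a%ℕn+[a/ℕn]*n a 2
... | 0           | _            | a≡ = inj₁ (divides (a /ℕ 2) (trans a≡ (ℤ.+-identityˡ _)))
... | suc (suc _) | s≤s (s≤s ()) | _
... | 1           | _            | a≡ =
  inj₂ (divides (a /ℕ 2 + + 1) (trans (cong (_+ + 1) a≡) (carry (a /ℕ 2))))
  where
  carry : ∀ h → + 1 + h * + 2 + + 1 ≡ (h + + 1) * + 2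
  carry = solve-∀

even-2* : ∀ a → Even (+ 2 * a)
even-2* a = ∣m⇒∣m*n a ∣-refl

even-i*i-i : ∀ a → Even (a * a - a)
even-i*i-i a with parity a
... | inj₁ 2∣a   = ∣m∣n⇒∣m-n (∣n⇒∣m*n a 2∣a) 2∣a
... | inj₂ 2∣a+1 = subst Even (consecutive a) (∣m∣n⇒∣m-n (∣n⇒∣m*n a 2∣a+1) (even-2* a))
  where
  consecutive : ∀ a → a * (a + + 1) - + 2 * a ≡ a * a - a
  consecutive = solve-∀

even-n₃⇒even-sum : ∀ x y z t → Even (n₃ (quat x y z t)) → Even (x + y + z + t)
even-n₃⇒even-sum x y z t 2∣n₃ = subst Even (sym (sum≡ x y z t))
  (∣m∣n⇒∣m+n (∣m∣n⇒∣m-n (∣m∣n⇒∣m+n (∣m∣n⇒∣m+n (∣m∣n⇒∣m-n 2∣n₃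
    (even-i*i-i x)) (even-i*i-i y)) (even-i*i-i z)) (even-i*i-i t)) (even-2* (y + z)))
  where
  sum≡ : ∀ x y z t → x + y + z + t
       ≡ (x * x - y * y - z * z + t * t) - (x * x - x) + (y * y - y) + (z * z - z) - (t * t - t) + + 2 * (y + z)
  sum≡ = solve-∀

x-y≡c⇒x≡y+c : ∀ {x y c} → x - y ≡ c → x ≡ y + c
x-y≡c⇒x≡y+c {x} {y} x-y≡c = trans (y+[x-y] x y) (cong (λ d → y + d) x-y≡c)
  where
  y+[x-y] : ∀ x y → x ≡ y + (x - y)
  y+[x-y] = solve-∀

1+i-divides : ∀ {x y z t} → Even (x - y) → Even (z - t) → EtaDivisible (quat x y z t)
1+i-divides {y = y} {t = t} (divides α x-y≡) (divides β z-t≡) =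
  quat (y + α) (- α) β (t + β) , _ , one+i ,
  quat-cong (trans (x-y≡c⇒x≡y+c x-y≡) (solve (y ∷ t ∷ α ∷ β ∷ [])))
            (solve (y ∷ t ∷ α ∷ β ∷ []))
            (trans (x-y≡c⇒x≡y+c z-t≡) (solve (y ∷ t ∷ α ∷ β ∷ [])))
            (solve (y ∷ t ∷ α ∷ β ∷ []))

1+j-divides : ∀ {x y z t} → Even (x - z) → Even (y - t) → EtaDivisible (quat x y z t)
1+j-divides {z = z} {t = t} (divides α x-z≡) (divides β y-t≡) =
  quat (z + α) (t + β) (- α) (- β) , _ , one+j ,
  quat-cong (trans (x-y≡c⇒x≡y+c x-z≡) (solve (z ∷ t ∷ α ∷ β ∷ [])))
            (trans (x-y≡c⇒x≡y+c y-t≡) (solve (z ∷ t ∷ α ∷ β ∷ [])))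
            (solve (z ∷ t ∷ α ∷ β ∷ []))
            (solve (z ∷ t ∷ α ∷ β ∷ []))

1+k-divides : ∀ {x y z t} → Even (x - t) → Even (y - z) → EtaDivisible (quat x y z t)
1+k-divides {z = z} {t = t} (divides α x-t≡) (divides β y-z≡) =
  quat (t + α) β (z + β) (- α) , _ , α+βk (+ 1) (+ 1) (+<+ (ℕ.n<1+n 1)) ,
  quat-cong (trans (x-y≡c⇒x≡y+c x-t≡) (solve (z ∷ t ∷ α ∷ β ∷ [])))
            (trans (x-y≡c⇒x≡y+c y-z≡) (solve (z ∷ t ∷ α ∷ β ∷ [])))
            (solve (z ∷ t ∷ α ∷ β ∷ []))
            (solve (z ∷ t ∷ α ∷ β ∷ []))

-- As x + y + z + t is even, x has the parity of one of y, z, t, and the remaining two agree.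
even-n₃⇒EtaDivisible : ∀ q → Even (n₃ q) → EtaDivisible q
even-n₃⇒EtaDivisible (quat x y z t) even-n₃ = byParity (parity (x - y)) (parity (x - z))
  where
  even-s : Even (x + y + z + t)
  even-s = even-n₃⇒even-sum x y z t even-n₃
  z-t≡ : ∀ x y z t → z - t ≡ (x + y + z + t) - (x - y) - + 2 * (y + t)
  z-t≡ = solve-∀
  y-t≡ : ∀ x y z t → y - t ≡ (x + y + z + t) - (x - z) - + 2 * (z + t)
  y-t≡ = solve-∀
  x-t≡ : ∀ x y z t → x - t ≡ (x - y + + 1) + (x - z + + 1) - (x + y + z + t) + + 2 * (y + z - + 1)
  x-t≡ = solve-∀
  y-z≡ : ∀ x y z → y - z ≡ (x - z + + 1) - (x - y + + 1)
  y-z≡ = solve-∀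
  byParity : Even (x - y) ⊎ Even (x - y + + 1) → Even (x - z) ⊎ Even (x - z + + 1) →
             EtaDivisible (quat x y z t)
  byParity (inj₁ even[x-y]) _ = 1+i-divides even[x-y]
    (subst Even (sym (z-t≡ x y z t)) (∣m∣n⇒∣m-n (∣m∣n⇒∣m-n even-s even[x-y]) (even-2* (y + t))))
  byParity (inj₂ _) (inj₁ even[x-z]) = 1+j-divides even[x-z]
    (subst Even (sym (y-t≡ x y z t)) (∣m∣n⇒∣m-n (∣m∣n⇒∣m-n even-s even[x-z]) (even-2* (z + t))))
  byParity (inj₂ odd[x-y]) (inj₂ odd[x-z]) = 1+k-divides
    (subst Even (sym (x-t≡ x y z t))
      (∣m∣n⇒∣m+n (∣m∣n⇒∣m-n (∣m∣n⇒∣m+n odd[x-y] odd[x-z]) even-s) (even-2* (y + z - + 1))))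
    (subst Even (sym (y-z≡ x y z)) (∣m∣n⇒∣m-n odd[x-z] odd[x-y]))

proposition2p9 : (q : ℍℤ) → 1 < gcd3 (n₁ q) (n₂ q) (n₃ q) →
    ∃[ q' ] ∃[ η ] (Eta η × q ≡ q' · η)
proposition2p9 q 1<m = byGcdNorm (bézout (k-part q) (i-part q))
  where
  q≡ = k-part+i·i-part q
  byGcdNorm : Bézout (k-part q) (i-part q) → EtaDivisible q
  byGcdNorm B with norm (Bézout.gcd B) in N[gcd]≡
  ... | 0           = subst EtaDivisible (sym q≡) (norm[gcd]≡0⇒EtaDivisible B N[gcd]≡)
  ... | suc (suc _) = subst EtaDivisible (sym q≡)
                        (1<norm[gcd]⇒EtaDivisible B (subst (1 <_) (sym N[gcd]≡) (s≤s (s≤s z≤n))))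
  ... | 1           = even-n₃⇒EtaDivisible q (subst (λ m → + m ∣ n₃ q) m≡2 (gcd3∣₃ (n₁ q) (n₂ q) (n₃ q)))
    where
    m≡2 : gcd3 (n₁ q) (n₂ q) (n₃ q) ≡ 2
    m≡2 = ℕ.≤-antisym (ℕ.∣⇒≤ (coprime-parts⇒gcd3∣2 q (norm[gcd]≡1⇒coprime B N[gcd]≡))) 1<m
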